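{- Let $\sigma_1,\sigma_2$ be RAM memory states and let $p$ be a basic RAM property. If $\sigma_1 \restriction \mathrm{ireg}(p) = \sigma_2 \restriction \mathrm{ireg}(p)$, then $p(\sigma_1) = p(\sigma_2)$.
   Context: Let $\{0,1\}^*$ denote the set of finite bit strings and $\varepsilon$ the empty bit string. A RAM memory state is a function $\sigma:\mathbb{N}\to\{0,1\}^*$ such that there exists $i\in\mathbb{N}$ with $\sigma(i+j)=\varepsilon$ for all $j\in\mathbb{N}$; let $\mathit{MS}$ be the set of all RAM memory states. For a function $p:\mathit{MS}\to\{0,1\}$ define its input region $\mathrm{ireg}(p)=\{i\in\mathbb{N} : \exists \sigma_1,\sigma_2\in\mathit{MS}\ (\forall j\in\mathbb{N}\setminus\{i\}\ \sigma_1(j)=\sigma_2(j)) \wedge p(\sigma_1)\neq p(\sigma_2)\}$. A basic RAM property is a function $p:\mathit{MS}\to\{0,1\}$ such that $\mathrm{ireg}(p)$ is finite. For a function $f$ and $D\subseteq\mathrm{dom}(f)$, $f\restriction D$ denotes the restriction of $f$ to $D$. -}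

module Defs where

open import Data.Bool using (Bool)
open import Data.List using (List; [])
open import Data.Nat using (ℕ; _+_)
open import Data.Product using (Σ; ∃; ∃-syntax; _×_; proj₁)
open import Data.List.Membership.Propositional using (_∈_)
open import Relation.Binary.PropositionalEquality using (_≡_; _≢_)

-- finite bit strings; ε is the empty list []
BitString : Set
BitString = List Bool

IsMemoryState : (ℕ → BitString) → Set
IsMemoryState σ = ∃[ i ] (∀ (j : ℕ) → σ (i + j) ≡ [])

MS : Set
MS = Σ (ℕ → BitString) IsMemoryState

cell : MS → ℕ → BitString
cell = proj₁

InIreg : (MS → Bool) → ℕ → Set
InIreg p i = ∃[ σ₁ ] ∃[ σ₂ ]
  ((∀ (j : ℕ) → j ≢ i → cell σ₁ j ≡ cell σ₂ j) × (p σ₁ ≢ p σ₂))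

-- ireg(p) is finite: contained in (the members of) some finite list
IsBasicRAMProperty : (MS → Bool) → Set
IsBasicRAMProperty p = ∃[ L ] (∀ (i : ℕ) → InIreg p i → i ∈ L)

AgreeOnIreg : (MS → Bool) → MS → MS → Set
AgreeOnIreg p σ₁ σ₂ = ∀ (i : ℕ) → InIreg p i → cell σ₁ i ≡ cell σ₂ i

{-# OPTIONS --safe #-}
module Submission where

-- If p σ₁ ≢ p σ₂ for two states that agree pointwise, every index would
-- witness membership of ireg(p), contradicting its finiteness; so p only
-- sees cell contents. Two memory states differ at finitely many cells, so
-- σ₁ can be turned into σ₂ one cell at a time. Changing a cell outside
-- ireg(p) cannot change p (else the cell would lie in ireg(p)), and on
-- ireg(p) the cells of σ₁ and σ₂ coincide anyway.

open import Defs
open import Data.Bool using (Bool)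
open import Data.Bool.Properties using () renaming (_≟_ to _≟ᵇ_)
open import Data.Empty using (⊥-elim)
open import Data.List using (List; []; _∷_)
open import Data.List.Membership.Propositional using (_∈_; _∉_)
open import Data.List.Relation.Unary.Any using (here; there)
open import Data.Nat using (ℕ; zero; suc; _+_; _∸_; _≤_; _<?_)
open import Data.Nat.ListAction using (sum)
open import Data.Nat.Properties
open import Data.Product using (_,_; proj₁; proj₂)
open import Function using (_∘_)
open import Relation.Nullary using (yes; no)
open import Relation.Binary.PropositionalEquality

∈⇒≤sum : ∀ {n} {ns : List ℕ} → n ∈ ns → n ≤ sum ns
∈⇒≤sum {ns = m ∷ ns} (here refl)  = m≤m+n m (sum ns)
∈⇒≤sum {ns = m ∷ ns} (there n∈ns) = ≤-trans (∈⇒≤sum n∈ns) (m≤n+m (sum ns) m)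

suc-sum-∉ : (ns : List ℕ) → suc (sum ns) ∉ ns
suc-sum-∉ ns = 1+n≰n ∘ ∈⇒≤sum

bound : MS → ℕ
bound = proj₁ ∘ proj₂

cell-beyond-bound : (σ : MS) {k : ℕ} → bound σ ≤ k → cell σ k ≡ []
cell-beyond-bound (f , i , empty) {k} i≤k =
  subst (λ x → f x ≡ []) (m+[n∸m]≡n i≤k) (empty (k ∸ i))

splice : MS → MS → ℕ → ℕ → BitString
splice σ₁ σ₂ n j with j <? n
... | yes _ = cell σ₂ j
... | no _  = cell σ₁ j

splice-beyond-bounds : (σ₁ σ₂ : MS) (n : ℕ) {k : ℕ} →
  bound σ₁ + bound σ₂ ≤ k → splice σ₁ σ₂ n k ≡ []
splice-beyond-bounds σ₁ σ₂ n {k} b≤k with k <? n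
... | yes _ = cell-beyond-bound σ₂ (≤-trans (m≤n+m _ _) b≤k)
... | no _  = cell-beyond-bound σ₁ (≤-trans (m≤m+n _ _) b≤k)

hybrid : MS → MS → ℕ → MS
hybrid σ₁ σ₂ n =
  splice σ₁ σ₂ n , bound σ₁ + bound σ₂ , λ j → splice-beyond-bounds σ₁ σ₂ n (m≤m+n _ j)

hybrid-zero : (σ₁ σ₂ : MS) → cell (hybrid σ₁ σ₂ 0) ≗ cell σ₁
hybrid-zero σ₁ σ₂ j = refl

hybrid-beyond-bounds : (σ₁ σ₂ : MS) → cell (hybrid σ₁ σ₂ (bound σ₁ + bound σ₂)) ≗ cell σ₂
hybrid-beyond-bounds σ₁ σ₂ j with j <? bound σ₁ + bound σ₂
... | yes _  = refl
... | no j≮b = trans (cell-beyond-bound σ₁ (≤-trans (m≤m+n _ _) (≮⇒≥ j≮b)))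
                     (sym (cell-beyond-bound σ₂ (≤-trans (m≤n+m _ _) (≮⇒≥ j≮b))))

hybrid-suc-off : (σ₁ σ₂ : MS) (n j : ℕ) → j ≢ n →
  cell (hybrid σ₁ σ₂ n) j ≡ cell (hybrid σ₁ σ₂ (suc n)) j
hybrid-suc-off σ₁ σ₂ n j j≢n with j <? n | j <? suc n
... | yes _   | yes _    = refl
... | no _    | no _     = refl
... | yes j<n | no j≮1+n = ⊥-elim (j≮1+n (m<n⇒m<1+n j<n))
... | no j≮n  | yes j<1+n = ⊥-elim (j≢n (≤-antisym (≤-pred j<1+n) (≮⇒≥ j≮n)))

hybrid-self-at : (σ₁ σ₂ : MS) (n : ℕ) → cell (hybrid σ₁ σ₂ n) n ≡ cell σ₁ n
hybrid-self-at σ₁ σ₂ n with n <? n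
... | yes n<n = ⊥-elim (<-irrefl refl n<n)
... | no _    = refl

hybrid-suc-at : (σ₁ σ₂ : MS) (n : ℕ) → cell (hybrid σ₁ σ₂ (suc n)) n ≡ cell σ₂ n
hybrid-suc-at σ₁ σ₂ n with n <? suc n
... | yes _    = refl
... | no n≮1+n = ⊥-elim (n≮1+n (n<1+n n))

module _ {p : MS → Bool} (basic : IsBasicRAMProperty p) where

  respects-≗ : (σ₁ σ₂ : MS) → cell σ₁ ≗ cell σ₂ → p σ₁ ≡ p σ₂
  respects-≗ σ₁ σ₂ σ₁≗σ₂ with p σ₁ ≟ᵇ p σ₂
  ... | yes eq = eq
  ... | no neq = ⊥-elim (suc-sum-∉ L (proj₂ basic (suc (sum L)) (σ₁ , σ₂ , (λ j _ → σ₁≗σ₂ j) , neq)))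
    where
    L : List ℕ
    L = proj₁ basic

  respects-single-cell-change : (σ₁ σ₂ : MS) (n : ℕ) →
    (∀ j → j ≢ n → cell σ₁ j ≡ cell σ₂ j) →
    (InIreg p n → cell σ₁ n ≡ cell σ₂ n) → p σ₁ ≡ p σ₂
  respects-single-cell-change σ₁ σ₂ n off-n at-n with p σ₁ ≟ᵇ p σ₂
  ... | yes eq = eq
  ... | no neq = respects-≗ σ₁ σ₂ σ₁≗σ₂
    where
    σ₁≗σ₂ : cell σ₁ ≗ cell σ₂
    σ₁≗σ₂ j with j ≟ n
    ... | yes refl = at-n (σ₁ , σ₂ , off-n , neq)
    ... | no j≢n   = off-n j j≢n

  hybrid-suc : (σ₁ σ₂ : MS) → AgreeOnIreg p σ₁ σ₂ → (n : ℕ) →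
    p (hybrid σ₁ σ₂ n) ≡ p (hybrid σ₁ σ₂ (suc n))
  hybrid-suc σ₁ σ₂ agree n =
    respects-single-cell-change (hybrid σ₁ σ₂ n) (hybrid σ₁ σ₂ (suc n)) n
      (hybrid-suc-off σ₁ σ₂ n)
      (λ n∈ireg → trans (hybrid-self-at σ₁ σ₂ n)
                        (trans (agree n n∈ireg) (sym (hybrid-suc-at σ₁ σ₂ n))))

  hybrid-invariant : (σ₁ σ₂ : MS) → AgreeOnIreg p σ₁ σ₂ → (n : ℕ) →
    p (hybrid σ₁ σ₂ 0) ≡ p (hybrid σ₁ σ₂ n)
  hybrid-invariant σ₁ σ₂ agree zero    = refl
  hybrid-invariant σ₁ σ₂ agree (suc n) =
    trans (hybrid-invariant σ₁ σ₂ agree n) (hybrid-suc σ₁ σ₂ agree n)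

theorem6 : (σ₁ σ₂ : MS) (p : MS → Bool) → IsBasicRAMProperty p →
    AgreeOnIreg p σ₁ σ₂ → p σ₁ ≡ p σ₂
theorem6 σ₁ σ₂ p basic agree = begin
  p σ₁                    ≡⟨ respects-≗ basic σ₁ (hybrid σ₁ σ₂ 0) (sym ∘ hybrid-zero σ₁ σ₂) ⟩
  p (hybrid σ₁ σ₂ 0)      ≡⟨ hybrid-invariant basic σ₁ σ₂ agree N ⟩
  p (hybrid σ₁ σ₂ N)      ≡⟨ respects-≗ basic (hybrid σ₁ σ₂ N) σ₂ (hybrid-beyond-bounds σ₁ σ₂) ⟩
  p σ₂                    ∎
  where
  open ≡-Reasoning
  N : ℕ
  N = bound σ₁ + bound σ₂
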